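{- Let $i,j\in\{1,2,3\}$, let $m\in\{8-i,9-i,10-i\}$, $n\in\{8-j,9-j,10-j\}$, and let $s,t$ be non-negative integers. Then \[ |P_{3,3}(T,(5+3s)\times(5+3t))| = |P_{i,j}(T,(m+3s)\times(n+3t))|. \]
   Context: Work over the alphabet $\{0,1\}$ and regard patterns as binary matrices (rows from the top, columns from the left). The block substitution $\mu$ maps $0$ to the $3\times3$ matrix with rows $(1,0,1),(0,0,0),(1,0,1)$ and $1$ to the $3\times3$ matrix with rows $(0,1,0),(1,1,1),(0,1,0)$; it acts on an $m\times n$ binary matrix by replacing each entry by its $3\times3$ image block (giving a $3m\times3n$ matrix). Let $T_k=\mu^k(0)$; the squiral tiling $T$ is their limit, and $P(T,m\times n)=\bigcup_{k\ge0}P(T_k,m\times n)$, where $P(S,m\times n)$ is the set of $m\times n$ contiguous submatrices of $S$. For a finite pattern $S$, $S[r,c,m\times n]$ denotes the $m\times n$ submatrix of $S$ with upper-left corner at row $r$, column $c$. For $i,j\in\{1,2,3\}$, $P_{i,j}(T,m\times n):=\{\mu(x)[i,j,m\times n] : x\in P(T,m\times n)\}$. -}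

module Defs where

open import Data.Bool using (Bool; true; false; not; _∧_; _∨_)
open import Data.Nat using (ℕ; zero; suc; _+_; _*_; _∸_; _^_; _≤_; _/_; _%_)
open import Data.Fin using (Fin; toℕ; remQuot)
open import Data.Vec using (Vec; []; _∷_; tabulate; lookup)
open import Data.List using (List; length)
open import Data.List.Membership.Propositional using (_∈_)
open import Data.List.Relation.Unary.Unique.Propositional using (Unique)
open import Data.Product using (Σ; ∃; _×_; proj₁; proj₂)
open import Data.Sum using (_⊎_)
open import Function.Bundles using (_⇔_)
open import Relation.Binary.PropositionalEquality using (_≡_)

-- Alphabet {0,1} is Bool (0 = false, 1 = true).
-- An m×n binary matrix: a vector of m rows, each of n entries.
Matrix : ℕ → ℕ → Set
Matrix m n = Vec (Vec Bool n) m

isMid : ℕ → Bool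
isMid 1 = true
isMid _ = false

-- entry (r,c) (0-indexed, r,c < 3) of the block μ(b)
-- μ(0) = (1,0,1),(0,0,0),(1,0,1) ; μ(1) = (0,1,0),(1,1,1),(0,1,0)
block : Bool → ℕ → ℕ → Bool
block false r c = not (isMid r) ∧ not (isMid c)
block true  r c = isMid r ∨ isMid c

μM : ∀ {m n} → Matrix m n → Matrix (m * 3) (n * 3)
μM {m} {n} x = tabulate λ i → tabulate λ j →
  block (lookup (lookup x (proj₁ (remQuot {m} 3 i))) (proj₁ (remQuot {n} 3 j)))
        (toℕ (proj₂ (remQuot {m} 3 i))) (toℕ (proj₂ (remQuot {n} 3 j)))

-- T_k = μ^k(0), as a function of 0-indexed (row, column); meaningful for
-- row, column < 3^k.  T_{k+1} = μ(T_k): entry (r,c) is entry (r mod 3, c mod 3)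
-- of the block μ(T_k(r div 3, c div 3)).
T : ℕ → ℕ → ℕ → Bool
T zero    r c = false
T (suc k) r c = block (T k (r / 3) (c / 3)) (r % 3) (c % 3)

-- m×n window with 0-indexed upper-left corner (r,c) of a pattern given as a function
window : (ℕ → ℕ → Bool) → ℕ → ℕ → (m n : ℕ) → Matrix m n
window f r c m n = tabulate λ i → tabulate λ j → f (r + toℕ i) (c + toℕ j)

-- a finite matrix as a function of 0-indexed (row, column) (false outside its range)
entryRow : ∀ {n} → Vec Bool n → ℕ → Bool
entryRow []       _       = false
entryRow (b ∷ _)  zero    = b
entryRow (_ ∷ bs) (suc c) = entryRow bs c

entry : ∀ {m n} → Matrix m n → ℕ → ℕ → Bool
entry []        _       c = false
entry (row ∷ _) zero    c = entryRow row c
entry (_ ∷ x)   (suc r) c = entry x r c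

-- S[r,c,m×n] with 1-indexed upper-left corner (r,c), as in the paper
sub : ∀ {p q} → Matrix p q → ℕ → ℕ → (m n : ℕ) → Matrix m n
sub S r c m n = window (entry S) (r ∸ 1) (c ∸ 1) m n

InP : (m n : ℕ) → Matrix m n → Set
InP m n x = ∃ λ k → ∃ λ r → ∃ λ c →
  (r + m ≤ 3 ^ k) × (c + n ≤ 3 ^ k) × (x ≡ window (T k) r c m n)

InPij : (i j m n : ℕ) → Matrix m n → Set
InPij i j m n y = ∃ λ (x : Matrix m n) → InP m n x × (y ≡ sub (μM x) i j m n)

-- a set A of m×n matrices (given as a predicate) is finite with exactly N elements:
-- it is enumerated by a duplicate-free list of length N
HasCard : ∀ {m n} → (Matrix m n → Set) → ℕ → Set
HasCard {m} {n} A N = Σ (List (Matrix m n)) λ xs →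
  (length xs ≡ N) × Unique xs × (∀ x → A x ⇔ x ∈ xs)

{-# OPTIONS --safe #-}
-- Both sides count P(T, (3+s)×(3+t)). For x ∈ P(T, M×N) with M = m + 3s, N = n + 3t, the window
-- μ(x)[i,j,M×N] lies inside μ of the top-left (3+s)×(3+t) part z of x and meets every block μ(z_αβ)
-- in a corner, which carries ¬z_αβ. Hence z ↦ μ(z)[i,j,M×N] is injective, and it maps P(T,(3+s)×(3+t))
-- onto P_{i,j}(T, M×N) because T_k is the top-left corner of T_{k+2}. Finally P(T, a×b) is finite: a
-- window of size at most 3^K of some T_k lies in μ^K of a 2×2 window of a deeper level, all those 2×2
-- windows already occur in T_2 (the 2×2 windows of T_2 are closed under μ, checked by evaluation), so
-- the window occurs in T_{K+2}.
module Submission where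

open import Defs
open import Data.Bool using (Bool; true; false; not)
import Data.Bool.Properties as Bool
open import Data.Nat using (ℕ; zero; suc; _+_; _*_; _∸_; _^_; _≤_; _<_; _/_; _%_; NonZero; z≤n; s≤s; _≤?_)
open import Data.Nat.Properties
open import Data.Nat.DivMod
open import Data.Nat.Divisibility using (m∣m*n)
open import Data.Nat.Tactic.RingSolver using (solve-∀)
open import Data.Fin using (Fin; toℕ; fromℕ<; remQuot)
open import Data.Fin.Properties using (toℕ-fromℕ<; toℕ<n; combine-remQuot; toℕ-combine)
open import Data.Vec using (Vec; _∷_; tabulate; lookup)
open import Data.Vec.Properties using (lookup∘tabulate; tabulate-cong; tabulate∘lookup; ≡-dec)
open import Data.List using (List; map; filter; cartesianProduct; upTo; deduplicate; length)
open import Data.List.Properties using (length-map)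
open import Data.List.Membership.Propositional using (_∈_)
open import Data.List.Membership.Propositional.Properties
open import Data.List.Relation.Unary.All as All using (All; all?)
open import Data.List.Relation.Unary.Unique.Propositional.Properties as Unique using ()
open import Data.List.Relation.Unary.Unique.DecPropositional.Properties using (deduplicate-!)
open import Data.Product using (∃; ∃₂; _×_; _,_; proj₁; proj₂)
open import Data.Sum using (_⊎_; inj₁; inj₂; [_,_]′)
open import Function.Bundles using (_⇔_; mk⇔; Equivalence)
import Function.Properties.Equivalence as ⇔
open import Function.Definitions using (Injective)
open import Relation.Binary.Definitions using (DecidableEquality)
open import Relation.Nullary using (Dec)
open import Relation.Nullary.Decidable using (_×-dec_; from-yes)
open import Relation.Binary.PropositionalEquality

[n*q+x]/n≡q+x/n : ∀ n .{{_ : NonZero n}} q x → (n * q + x) / n ≡ q + x / n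
[n*q+x]/n≡q+x/n n q x = begin
  (n * q + x) / n    ≡⟨ +-distrib-/-∣ˡ x (m∣m*n q) ⟩
  n * q / n + x / n  ≡⟨ cong (_+ x / n) (trans (/-congˡ (*-comm n q)) (m*n/n≡m q n)) ⟩
  q + x / n          ∎
  where open ≡-Reasoning

[n*q+x]%n≡x%n : ∀ n .{{_ : NonZero n}} q x → (n * q + x) % n ≡ x % n
[n*q+x]%n≡x%n n q x = %-remove-+ˡ x (m∣m*n q)

n<3^n : ∀ n → n < 3 ^ n
n<3^n zero    = s≤s z≤n
n<3^n (suc n) = ≤-trans (+-mono-≤ (m^n>0 3 n) (n<3^n n)) (+-monoʳ-≤ (3 ^ n) (m≤m+n (3 ^ n) (3 ^ n + 0)))

2≤3^suc : ∀ n → 2 ≤ 3 ^ suc n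
2≤3^suc n = ≤-trans (s≤s (s≤s z≤n)) (n<3^n (suc n))

InTwoBlocks : (N Q a r : ℕ) → Set
InTwoBlocks N Q a r = ∃₂ λ q ρ → r ≡ N * q + ρ × ρ + a ≤ 2 * N × q + 2 ≤ Q

withinTwoBlocks : ∀ {N a} Q r → a ≤ N → r + a ≤ N * Q → 2 ≤ Q → InTwoBlocks N Q a r
withinTwoBlocks zero _ _ _ ()
withinTwoBlocks (suc zero) _ _ _ (s≤s ())
withinTwoBlocks {N} {a} (suc (suc zero)) r _ r+a≤ _ =
  0 , r , sym (cong (_+ r) (*-zeroʳ N)) , subst (r + a ≤_) (*-comm N 2) r+a≤ , ≤-refl
withinTwoBlocks {N} {a} (suc Q@(suc (suc _))) r a≤N r+a≤ _ =
  [ (λ N≤r → dropBlock N≤r (withinTwoBlocks Q (r ∸ N) a≤N (r∸N+a≤ N≤r) (s≤s (s≤s z≤n)))) , firstBlock ]′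
    (≤-<-connex N r)
  where
  firstBlock : r < N → InTwoBlocks N (suc Q) a r
  firstBlock r<N = 0 , r , sym (cong (_+ r) (*-zeroʳ N)) , r+a≤2N , s≤s (s≤s z≤n)
    where
    r+a≤2N : r + a ≤ 2 * N
    r+a≤2N = ≤-trans (+-mono-≤ (<⇒≤ r<N) a≤N) (≤-reflexive (cong (N +_) (sym (+-identityʳ N))))

  r∸N+a≤ : N ≤ r → r ∸ N + a ≤ N * Q
  r∸N+a≤ N≤r = +-cancelˡ-≤ N _ _ (begin
    N + (r ∸ N + a)  ≡⟨ +-assoc N (r ∸ N) a ⟨
    N + (r ∸ N) + a  ≡⟨ cong (_+ a) (m+[n∸m]≡n N≤r) ⟩
    r + a            ≤⟨ r+a≤ ⟩
    N * suc Q        ≡⟨ *-suc N Q ⟩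
    N + N * Q        ∎)
    where open ≤-Reasoning

  dropBlock : N ≤ r → InTwoBlocks N Q a (r ∸ N) → InTwoBlocks N (suc Q) a r
  dropBlock N≤r (q , ρ , r∸N≡ , ρ+a≤ , q+2≤) = suc q , ρ , r≡ , ρ+a≤ , s≤s q+2≤
    where
    open ≡-Reasoning
    r≡ : r ≡ N * suc q + ρ
    r≡ = begin
      r                ≡⟨ m+[n∸m]≡n N≤r ⟨
      N + (r ∸ N)      ≡⟨ cong (N +_) r∸N≡ ⟩
      N + (N * q + ρ)  ≡⟨ +-assoc N (N * q) ρ ⟨
      N + N * q + ρ    ≡⟨ cong (_+ ρ) (*-suc N q) ⟨
      N * suc q + ρ    ∎

withinTwoBlocks-inside : ∀ N {Q q ρ a} → ρ + a ≤ 2 * N → q + 2 ≤ Q → N * q + ρ + a ≤ N * Q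
withinTwoBlocks-inside N {Q} {q} {ρ} {a} ρ+a≤ q+2≤ = begin
  N * q + ρ + a      ≡⟨ +-assoc (N * q) ρ a ⟩
  N * q + (ρ + a)    ≤⟨ +-monoʳ-≤ (N * q) ρ+a≤ ⟩
  N * q + 2 * N      ≡⟨ cong (N * q +_) (*-comm 2 N) ⟩
  N * q + N * 2      ≡⟨ *-distribˡ-+ N q 2 ⟨
  N * (q + 2)        ≤⟨ *-monoʳ-≤ N q+2≤ ⟩
  N * Q              ∎
  where open ≤-Reasoning

-- Substitution on infinite patterns

Pattern : Set
Pattern = ℕ → ℕ → Bool

μP : Pattern → Pattern
μP f r c = block (f (r / 3) (c / 3)) (r % 3) (c % 3)

μP^ : ℕ → Pattern → Pattern
μP^ zero    f = f
μP^ (suc K) f = μP (μP^ K f)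

shift : Pattern → ℕ → ℕ → Pattern
shift f r c u v = f (r + u) (c + v)

AgreeOn : ℕ → ℕ → Pattern → Pattern → Set
AgreeOn m n f g = ∀ {u v} → u < m → v < n → f u v ≡ g u v

AgreeOn-sym : ∀ {m n f g} → AgreeOn m n f g → AgreeOn m n g f
AgreeOn-sym f≐g u< v< = sym (f≐g u< v<)

AgreeOn-mono : ∀ {m n m′ n′ f g} → m′ ≤ m → n′ ≤ n → AgreeOn m n f g → AgreeOn m′ n′ f g
AgreeOn-mono m′≤m n′≤n f≐g u< v< = f≐g (<-≤-trans u< m′≤m) (<-≤-trans v< n′≤n)

AgreeOn-shift : ∀ {m n a b f g} r c → r + a ≤ m → c + b ≤ n →
                AgreeOn m n f g → AgreeOn a b (shift f r c) (shift g r c)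
AgreeOn-shift r c r+a≤m c+b≤n f≐g u< v< =
  f≐g (<-≤-trans (+-monoʳ-< r u<) r+a≤m) (<-≤-trans (+-monoʳ-< c v<) c+b≤n)

μP-shift : ∀ f q p x y → μP f (3 * q + x) (3 * p + y) ≡ μP (shift f q p) x y
μP-shift f q p x y
  rewrite [n*q+x]/n≡q+x/n 3 q x | [n*q+x]/n≡q+x/n 3 p y
        | [n*q+x]%n≡x%n 3 q x | [n*q+x]%n≡x%n 3 p y = refl

μP^-shift : ∀ K f q p x y → μP^ K f (3 ^ K * q + x) (3 ^ K * p + y) ≡ μP^ K (shift f q p) x y
μP^-shift zero f q p x y = cong₂ (λ r c → f (r + x) (c + y)) (*-identityˡ q) (*-identityˡ p)
μP^-shift (suc K) f q p x y = begin
  μP (μP^ K f) (3 * 3 ^ K * q + x) (3 * 3 ^ K * p + y)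
    ≡⟨ cong₂ (λ r c → μP (μP^ K f) (r + x) (c + y)) (*-assoc 3 (3 ^ K) q) (*-assoc 3 (3 ^ K) p) ⟩
  μP (μP^ K f) (3 * (3 ^ K * q) + x) (3 * (3 ^ K * p) + y)
    ≡⟨ μP-shift (μP^ K f) (3 ^ K * q) (3 ^ K * p) x y ⟩
  μP (shift (μP^ K f) (3 ^ K * q) (3 ^ K * p)) x y
    ≡⟨ cong (λ b → block b (x % 3) (y % 3)) (μP^-shift K f q p (x / 3) (y / 3)) ⟩
  μP (μP^ K (shift f q p)) x y
    ∎
  where open ≡-Reasoning

μP-local : ∀ {m n f g} → AgreeOn m n f g → AgreeOn (m * 3) (n * 3) (μP f) (μP g)
μP-local f≐g u< v< = cong (λ b → block b _ _) (f≐g (m<n*o⇒m/o<n u<) (m<n*o⇒m/o<n v<))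

μP^-local : ∀ K {m n f g} → AgreeOn m n f g → AgreeOn (m * 3 ^ K) (n * 3 ^ K) (μP^ K f) (μP^ K g)
μP^-local zero    {m} {n} f≐g = AgreeOn-mono (≤-reflexive (*-identityʳ m)) (≤-reflexive (*-identityʳ n)) f≐g
μP^-local (suc K) {m} {n} f≐g =
  AgreeOn-mono (≤-reflexive (regroup m)) (≤-reflexive (regroup n)) (μP-local (μP^-local K f≐g))
  where
  regroup : ∀ m → m * (3 * 3 ^ K) ≡ m * 3 ^ K * 3
  regroup m = trans (cong (m *_) (*-comm 3 (3 ^ K))) (sym (*-assoc m (3 ^ K) 3))

window-cong : ∀ {a b} f r c g r′ c′ → AgreeOn a b (shift f r c) (shift g r′ c′) →
              window f r c a b ≡ window g r′ c′ a b
window-cong f r c g r′ c′ f≐g = tabulate-cong λ i → tabulate-cong λ j → f≐g (toℕ<n i) (toℕ<n j)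

window-cong-within : ∀ {m n a b} f g r c → r + a ≤ m → c + b ≤ n → AgreeOn m n f g →
                     window f r c a b ≡ window g r c a b
window-cong-within f g r c r+a≤m c+b≤n f≐g = window-cong f r c g r c (AgreeOn-shift r c r+a≤m c+b≤n f≐g)

entryRow-lookup : ∀ {n} (row : Vec Bool n) (j : Fin n) → entryRow row (toℕ j) ≡ lookup row j
entryRow-lookup (b ∷ row) Fin.zero    = refl
entryRow-lookup (b ∷ row) (Fin.suc j) = entryRow-lookup row j

entry-lookup : ∀ {m n} (x : Matrix m n) (i : Fin m) (j : Fin n) →
               entry x (toℕ i) (toℕ j) ≡ lookup (lookup x i) j
entry-lookup (row ∷ x) Fin.zero    j = entryRow-lookup row j
entry-lookup (row ∷ x) (Fin.suc i) j = entry-lookup x i j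

entry-fromℕ< : ∀ {m n u v} (x : Matrix m n) (u< : u < m) (v< : v < n) →
               entry x u v ≡ lookup (lookup x (fromℕ< u<)) (fromℕ< v<)
entry-fromℕ< x u< v< =
  trans (cong₂ (entry x) (sym (toℕ-fromℕ< u<)) (sym (toℕ-fromℕ< v<))) (entry-lookup x _ _)

entry-window : ∀ {a b} f r c → AgreeOn a b (entry (window f r c a b)) (shift f r c)
entry-window {a} {b} f r c u< v< = begin
  entry (window f r c a b) _ _
    ≡⟨ entry-fromℕ< (window f r c a b) u< v< ⟩
  lookup (lookup (window f r c a b) (fromℕ< u<)) (fromℕ< v<)
    ≡⟨ cong (λ row → lookup row (fromℕ< v<)) (lookup∘tabulate _ (fromℕ< u<)) ⟩
  lookup (tabulate λ j → f (r + toℕ (fromℕ< u<)) (c + toℕ j)) (fromℕ< v<)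
    ≡⟨ lookup∘tabulate _ (fromℕ< v<) ⟩
  f (r + toℕ (fromℕ< u<)) (c + toℕ (fromℕ< v<))
    ≡⟨ cong₂ (λ u v → f (r + u) (c + v)) (toℕ-fromℕ< u<) (toℕ-fromℕ< v<) ⟩
  f (r + _) (c + _)
    ∎
  where open ≡-Reasoning

window-entry : ∀ {m n} (x : Matrix m n) → window (entry x) 0 0 m n ≡ x
window-entry x = begin
  window (entry x) 0 0 _ _                        ≡⟨ tabulate-cong (λ i → tabulate-cong (entry-lookup x i)) ⟩
  tabulate (λ i → tabulate (lookup (lookup x i))) ≡⟨ tabulate-cong (λ i → tabulate∘lookup (lookup x i)) ⟩
  tabulate (lookup x)                             ≡⟨ tabulate∘lookup x ⟩
  x                                               ∎
  where open ≡-Reasoning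

entry-ext : ∀ {m n} {x y : Matrix m n} → AgreeOn m n (entry x) (entry y) → x ≡ y
entry-ext {x = x} {y} x≐y = begin
  x                         ≡⟨ window-entry x ⟨
  window (entry x) 0 0 _ _  ≡⟨ window-cong-within (entry x) (entry y) 0 0 ≤-refl ≤-refl x≐y ⟩
  window (entry y) 0 0 _ _  ≡⟨ window-entry y ⟩
  y                         ∎
  where open ≡-Reasoning

toℕ-remQuot : ∀ {m} k .{{_ : NonZero k}} (i : Fin (m * k)) →
              toℕ (proj₁ (remQuot {m} k i)) ≡ toℕ i / k × toℕ (proj₂ (remQuot {m} k i)) ≡ toℕ i % k
toℕ-remQuot {m} k i = sym quot , sym rem
  where
  q : Fin m
  q = proj₁ (remQuot {m} k i)
  r : Fin k
  r = proj₂ (remQuot {m} k i)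
  i≡ : toℕ i ≡ k * toℕ q + toℕ r
  i≡ = trans (cong toℕ (sym (combine-remQuot {m} k i))) (toℕ-combine q r)
  quot : toℕ i / k ≡ toℕ q
  quot = begin
    toℕ i / k                ≡⟨ /-congˡ i≡ ⟩
    (k * toℕ q + toℕ r) / k  ≡⟨ [n*q+x]/n≡q+x/n k (toℕ q) (toℕ r) ⟩
    toℕ q + toℕ r / k        ≡⟨ cong (toℕ q +_) (m<n⇒m/n≡0 (toℕ<n r)) ⟩
    toℕ q + 0                ≡⟨ +-identityʳ (toℕ q) ⟩
    toℕ q                    ∎
    where open ≡-Reasoning
  rem : toℕ i % k ≡ toℕ r
  rem = trans (cong (_% k) i≡) (trans ([n*q+x]%n≡x%n k (toℕ q) (toℕ r)) (m<n⇒m%n≡m (toℕ<n r)))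

entry-μM : ∀ {m n} (x : Matrix m n) → AgreeOn (m * 3) (n * 3) (entry (μM x)) (μP (entry x))
entry-μM {m} {n} x {R} {C} R< C< = begin
  entry (μM x) R C
    ≡⟨ entry-fromℕ< (μM x) R< C< ⟩
  lookup (lookup (μM x) R̂) Ĉ
    ≡⟨ cong (λ row → lookup row Ĉ) (lookup∘tabulate _ R̂) ⟩
  lookup (tabulate λ c′ → block (lookup (lookup x qR) (proj₁ (remQuot {n} 3 c′)))
                                (toℕ rR) (toℕ (proj₂ (remQuot {n} 3 c′)))) Ĉ
    ≡⟨ lookup∘tabulate _ Ĉ ⟩
  block (lookup (lookup x qR) qC) (toℕ rR) (toℕ rC)
    ≡⟨ cong (λ b → block b (toℕ rR) (toℕ rC)) (entry-lookup x qR qC) ⟨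
  block (entry x (toℕ qR) (toℕ qC)) (toℕ rR) (toℕ rC)
    ≡⟨ cong₂ (λ u v → block (entry x u v) (toℕ rR) (toℕ rC))
             (proj₁ (toℕ-remQuot {m} 3 R̂)) (proj₁ (toℕ-remQuot {n} 3 Ĉ)) ⟩
  block (entry x (toℕ R̂ / 3) (toℕ Ĉ / 3)) (toℕ rR) (toℕ rC)
    ≡⟨ cong₂ (block (entry x (toℕ R̂ / 3) (toℕ Ĉ / 3)))
             (proj₂ (toℕ-remQuot {m} 3 R̂)) (proj₂ (toℕ-remQuot {n} 3 Ĉ)) ⟩
  μP (entry x) (toℕ R̂) (toℕ Ĉ)
    ≡⟨ cong₂ (μP (entry x)) (toℕ-fromℕ< R<) (toℕ-fromℕ< C<) ⟩
  μP (entry x) R C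
    ∎
  where
  open ≡-Reasoning
  R̂ : Fin (m * 3)
  R̂ = fromℕ< R<
  Ĉ : Fin (n * 3)
  Ĉ = fromℕ< C<
  qR : Fin m
  qR = proj₁ (remQuot {m} 3 R̂)
  rR : Fin 3
  rR = proj₂ (remQuot {m} 3 R̂)
  qC : Fin n
  qC = proj₁ (remQuot {n} 3 Ĉ)
  rC : Fin 3
  rC = proj₂ (remQuot {n} 3 Ĉ)

sub-μM : ∀ {m n M N} (x : Matrix m n) i j → i ∸ 1 + M ≤ m * 3 → j ∸ 1 + N ≤ n * 3 →
         sub (μM x) i j M N ≡ window (μP (entry x)) (i ∸ 1) (j ∸ 1) M N
sub-μM x i j fitsᵢ fitsⱼ =
  window-cong-within (entry (μM x)) (μP (entry x)) (i ∸ 1) (j ∸ 1) fitsᵢ fitsⱼ (entry-μM x)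

sub-μM-window : ∀ {M N} f r c A B i j → i ∸ 1 + M ≤ A * 3 → j ∸ 1 + N ≤ B * 3 →
                sub (μM (window f r c A B)) i j M N ≡ window (μP (shift f r c)) (i ∸ 1) (j ∸ 1) M N
sub-μM-window f r c A B i j fitsᵢ fitsⱼ =
  trans (sub-μM (window f r c A B) i j fitsᵢ fitsⱼ)
        (window-cong-within (μP (entry (window f r c A B))) (μP (shift f r c)) (i ∸ 1) (j ∸ 1) fitsᵢ fitsⱼ
                            (μP-local (entry-window {A} {B} f r c)))

-- The squiral levels

T-+ : ∀ K j u v → T (K + j) u v ≡ μP^ K (T j) u v
T-+ zero    j u v = refl
T-+ (suc K) j u v = cong (λ b → block b (u % 3) (v % 3)) (T-+ K j (u / 3) (v / 3))

T-even-origin : ∀ d → T (2 * d) 0 0 ≡ false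
T-even-origin zero = refl
T-even-origin (suc d) rewrite +-suc d (d + 0) | T-even-origin d = refl

T-topLeft : ∀ k d → AgreeOn (3 ^ k) (3 ^ k) (T k) (T (k + 2 * d))
T-topLeft k d {u} {v} u< v< = begin
  T k u v                ≡⟨ cong (λ l → T l u v) (+-identityʳ k) ⟨
  T (k + 0) u v          ≡⟨ T-+ k 0 u v ⟩
  μP^ k (T 0) u v        ≡⟨ μP^-local k origin (lt u<) (lt v<) ⟩
  μP^ k (T (2 * d)) u v  ≡⟨ T-+ k (2 * d) u v ⟨
  T (k + 2 * d) u v      ∎
  where
  open ≡-Reasoning
  origin : AgreeOn 1 1 (T 0) (T (2 * d))
  origin (s≤s z≤n) (s≤s z≤n) = sym (T-even-origin d)
  lt : ∀ {u} → u < 3 ^ k → u < 1 * 3 ^ k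
  lt {u} = subst (u <_) (sym (*-identityˡ (3 ^ k)))

window-T-split : ∀ K j {a b} q p {ρ π} → ρ + a ≤ 2 * 3 ^ K → π + b ≤ 2 * 3 ^ K →
                 window (T (K + j)) (3 ^ K * q + ρ) (3 ^ K * p + π) a b
                   ≡ window (μP^ K (entry (window (T j) q p 2 2))) ρ π a b
window-T-split K j {a} {b} q p {ρ} {π} ρ+a≤ π+b≤ = begin
  window (T (K + j)) (3 ^ K * q + ρ) (3 ^ K * p + π) a b
    ≡⟨ window-cong (T (K + j)) (3 ^ K * q + ρ) (3 ^ K * p + π) (μP^ K (shift (T j) q p)) ρ π
                   (λ {u} {v} _ _ → unshift u v) ⟩
  window (μP^ K (shift (T j) q p)) ρ π a b
    ≡⟨ window-cong-within (μP^ K (shift (T j) q p)) (μP^ K (entry (window (T j) q p 2 2))) ρ π ρ+a≤ π+b≤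
         (μP^-local K (AgreeOn-sym (entry-window {2} {2} (T j) q p))) ⟩
  window (μP^ K (entry (window (T j) q p 2 2))) ρ π a b
    ∎
  where
  open ≡-Reasoning
  unshift : ∀ u v → T (K + j) (3 ^ K * q + ρ + u) (3 ^ K * p + π + v)
                      ≡ μP^ K (shift (T j) q p) (ρ + u) (π + v)
  unshift u v = begin
    T (K + j) (3 ^ K * q + ρ + u) (3 ^ K * p + π + v)
      ≡⟨ T-+ K j _ _ ⟩
    μP^ K (T j) (3 ^ K * q + ρ + u) (3 ^ K * p + π + v)
      ≡⟨ cong₂ (μP^ K (T j)) (+-assoc (3 ^ K * q) ρ u) (+-assoc (3 ^ K * p) π v) ⟩
    μP^ K (T j) (3 ^ K * q + (ρ + u)) (3 ^ K * p + (π + v))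
      ≡⟨ μP^-shift K (T j) q p (ρ + u) (π + v) ⟩
    μP^ K (shift (T j) q p) (ρ + u) (π + v)
      ∎

-- Every window of T occurs in a bounded level

-- InP a b x unfolds to ∃ λ k → Windows (T k) (3 ^ k) a b x.
Windows : Pattern → ℕ → (a b : ℕ) → Matrix a b → Set
Windows f L a b x = ∃ λ r → ∃ λ c → (r + a ≤ L) × (c + b ≤ L) × (x ≡ window f r c a b)

Inside : ℕ → ℕ → ℕ → ℕ × ℕ → Set
Inside L a b (r , c) = r + a ≤ L × c + b ≤ L

inside? : ∀ L a b rc → Dec (Inside L a b rc)
inside? L a b (r , c) = (r + a ≤? L) ×-dec (c + b ≤? L)

windowAt : Pattern → (a b : ℕ) → ℕ × ℕ → Matrix a b
windowAt f a b (r , c) = window f r c a b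

corners : ℕ → List (ℕ × ℕ)
corners L = cartesianProduct (upTo (suc L)) (upTo (suc L))

windowList : Pattern → ℕ → (a b : ℕ) → List (Matrix a b)
windowList f L a b = map (windowAt f a b) (filter (inside? L a b) (corners L))

Windows⇔∈windowList : ∀ f L {a b} x → Windows f L a b x ⇔ x ∈ windowList f L a b
Windows⇔∈windowList f L {a} {b} x = mk⇔ to from
  where
  to : Windows f L a b x → x ∈ windowList f L a b
  to (r , c , r+a≤ , c+b≤ , refl) =
    ∈-map⁺ (windowAt f a b)
      (∈-filter⁺ (inside? L a b)
        (∈-cartesianProduct⁺ (∈-upTo⁺ (s≤s (≤-trans (m≤m+n r a) r+a≤)))
                             (∈-upTo⁺ (s≤s (≤-trans (m≤m+n c b) c+b≤))))
        (r+a≤ , c+b≤))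
  from : x ∈ windowList f L a b → Windows f L a b x
  from x∈ with (r , c) , rc∈ , refl ← ∈-map⁻ (windowAt f a b) x∈
    with _ , r+a≤ , c+b≤ ← ∈-filter⁻ (inside? L a b) {xs = corners L} rc∈
    = r , c , r+a≤ , c+b≤ , refl

_≟ᴹ_ : ∀ {m n} → DecidableEquality (Matrix m n)
_≟ᴹ_ = ≡-dec (≡-dec Bool._≟_)

open import Data.List.Membership.DecPropositional (_≟ᴹ_ {2} {2}) using (_∈?_)

T₂-windows : List (Matrix 2 2)
T₂-windows = windowList (T 2) 9 2 2

T₂-windows-closed :
  All (λ w → All (λ ρ → All (λ π → window (μP (entry w)) ρ π 2 2 ∈ T₂-windows) (upTo 5)) (upTo 5)) T₂-windows
T₂-windows-closed = from-yes
  (all? (λ w → all? (λ ρ → all? (λ π → window (μP (entry w)) ρ π 2 2 ∈? T₂-windows) (upTo 5)) (upTo 5))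
        T₂-windows)

T₁-windows⊆T₂-windows : All (_∈ T₂-windows) (windowList (T 1) 3 2 2)
T₁-windows⊆T₂-windows = from-yes (all? (_∈? T₂-windows) (windowList (T 1) 3 2 2))

2×2-window∈T₂-windows : ∀ j {w} → Windows (T (suc j)) (3 ^ suc j) 2 2 w → w ∈ T₂-windows
2×2-window∈T₂-windows zero {w} w∈T₁ =
  All.lookup T₁-windows⊆T₂-windows (Equivalence.to (Windows⇔∈windowList (T 1) 3 w) w∈T₁)
2×2-window∈T₂-windows (suc j) (R , C , R+2≤ , C+2≤ , refl)
  with q , ρ , refl , ρ+2≤ , q+2≤ ← withinTwoBlocks {3} (3 ^ suc j) R (s≤s (s≤s z≤n)) R+2≤ (2≤3^suc j)
     | p , π , refl , π+2≤ , p+2≤ ← withinTwoBlocks {3} (3 ^ suc j) C (s≤s (s≤s z≤n)) C+2≤ (2≤3^suc j)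
  = subst (_∈ T₂-windows) (sym (window-T-split 1 (suc j) q p ρ+2≤ π+2≤))
      (All.lookup (All.lookup (All.lookup T₂-windows-closed w∈T₂) (∈upTo5 ρ+2≤)) (∈upTo5 π+2≤))
  where
  w∈T₂ : window (T (suc j)) q p 2 2 ∈ T₂-windows
  w∈T₂ = 2×2-window∈T₂-windows j (q , p , q+2≤ , p+2≤ , refl)
  ∈upTo5 : ∀ {ρ} → ρ + 2 ≤ 6 → ρ ∈ upTo 5
  ∈upTo5 {ρ} ρ+2≤6 = ∈-upTo⁺ (s≤s (+-cancelʳ-≤ 2 ρ 4 ρ+2≤6))

3^k≤3^K*3^[k+K+2] : ∀ k K → 3 ^ k ≤ 3 ^ K * 3 ^ suc (suc (k + K))
3^k≤3^K*3^[k+K+2] k K = ≤-trans (^-monoʳ-≤ 3 k≤K+j) (≤-reflexive (^-distribˡ-+-* 3 K j))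
  where
  j : ℕ
  j = suc (suc (k + K))
  k≤K+j : k ≤ K + j
  k≤K+j = ≤-trans (m≤m+n k K) (≤-trans (≤-trans (n≤1+n _) (n≤1+n _)) (m≤n+m j K))

InP→Windows : ∀ {a b K x} → a ≤ 3 ^ K → b ≤ 3 ^ K → InP a b x → Windows (T (K + 2)) (3 ^ (K + 2)) a b x
InP→Windows {a} {b} {K} a≤ b≤ (k , r , c , r+a≤ , c+b≤ , refl)
  with q , ρ , refl , ρ+a≤ , q+2≤ ← withinTwoBlocks {3 ^ K} _ r a≤ (≤-trans r+a≤ (3^k≤3^K*3^[k+K+2] k K))
                                                    (2≤3^suc (suc (k + K)))
     | p , π , refl , π+b≤ , p+2≤ ← withinTwoBlocks {3 ^ K} _ c b≤ (≤-trans c+b≤ (3^k≤3^K*3^[k+K+2] k K))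
                                                    (2≤3^suc (suc (k + K)))
  with q′ , p′ , q′+2≤ , p′+2≤ , w≡ ← Equivalence.from (Windows⇔∈windowList (T 2) 9 _)
                                        (2×2-window∈T₂-windows (suc (k + K)) (q , p , q+2≤ , p+2≤ , refl))
  = 3 ^ K * q′ + ρ , 3 ^ K * p′ + π , inside ρ+a≤ q′+2≤ , inside π+b≤ p′+2≤ , (begin
    window (T k) (3 ^ K * q + ρ) (3 ^ K * p + π) a b
      ≡⟨ window-cong-within (T k) (T (k + 2 * suc K)) _ _ r+a≤ c+b≤ (T-topLeft k (suc K)) ⟩
    window (T (k + 2 * suc K)) (3 ^ K * q + ρ) (3 ^ K * p + π) a b
      ≡⟨ cong (λ l → window (T l) (3 ^ K * q + ρ) (3 ^ K * p + π) a b) (level k K) ⟩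
    window (T (K + j)) (3 ^ K * q + ρ) (3 ^ K * p + π) a b
      ≡⟨ window-T-split K j q p ρ+a≤ π+b≤ ⟩
    window (μP^ K (entry (window (T j) q p 2 2))) ρ π a b
      ≡⟨ cong (λ w → window (μP^ K (entry w)) ρ π a b) w≡ ⟩
    window (μP^ K (entry (window (T 2) q′ p′ 2 2))) ρ π a b
      ≡⟨ window-T-split K 2 q′ p′ ρ+a≤ π+b≤ ⟨
    window (T (K + 2)) (3 ^ K * q′ + ρ) (3 ^ K * p′ + π) a b
      ∎)
  where
  open ≡-Reasoning
  -- T_k is the top-left corner of T_{K+j}, a level of the parity of k deep enough for withinTwoBlocks.
  j : ℕ
  j = suc (suc (k + K))

  level : ∀ k K → k + 2 * suc K ≡ K + suc (suc (k + K))
  level = solve-∀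

  inside : ∀ {q ρ a} → ρ + a ≤ 2 * 3 ^ K → q + 2 ≤ 9 → 3 ^ K * q + ρ + a ≤ 3 ^ (K + 2)
  inside ρ+a≤ q+2≤ =
    ≤-trans (withinTwoBlocks-inside (3 ^ K) ρ+a≤ q+2≤) (≤-reflexive (sym (^-distribˡ-+-* 3 K 2)))

HasCard-fromList : ∀ {m n} {A : Matrix m n → Set} xs → (∀ x → A x ⇔ x ∈ xs) →
                   HasCard A (length (deduplicate _≟ᴹ_ xs))
HasCard-fromList xs A⇔∈ =
  deduplicate _≟ᴹ_ xs , refl , deduplicate-! _≟ᴹ_ xs , λ x → ⇔.trans (A⇔∈ x) (deduplicate-∈⇔ _≟ᴹ_)

HasCard-image : ∀ {a b m n N} {A : Matrix a b → Set} {B : Matrix m n → Set} (f : Matrix a b → Matrix m n) →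
                Injective _≡_ _≡_ f → (∀ y → B y ⇔ ∃ λ x → A x × y ≡ f x) → HasCard A N → HasCard B N
HasCard-image {A = A} f f-injective B⇔image (xs , ∣xs∣≡N , xs-unique , A⇔∈) =
  map f xs , trans (length-map f xs) ∣xs∣≡N , Unique.map⁺ f-injective xs-unique ,
  λ y → ⇔.trans (B⇔image y) (mk⇔ to from)
  where
  to : ∀ {y} → (∃ λ x → A x × y ≡ f x) → y ∈ map f xs
  to (x , Ax , refl) = ∈-map⁺ f (Equivalence.to (A⇔∈ x) Ax)
  from : ∀ {y} → y ∈ map f xs → ∃ λ x → A x × y ≡ f x
  from y∈ with x , x∈ , refl ← ∈-map⁻ f y∈ = x , Equivalence.from (A⇔∈ x) x∈ , refl

InP-finite : ∀ a b → ∃ λ N → HasCard (InP a b) N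
InP-finite a b = _ , HasCard-fromList (windowList (T (K + 2)) (3 ^ (K + 2)) a b) InP⇔∈
  where
  K : ℕ
  K = a + b
  InP⇔∈ : ∀ x → InP a b x ⇔ x ∈ windowList (T (K + 2)) (3 ^ (K + 2)) a b
  InP⇔∈ x =
    ⇔.trans (mk⇔ (InP→Windows {K = K} a≤3^K b≤3^K) (K + 2 ,_)) (Windows⇔∈windowList (T (K + 2)) _ x)
    where
    a≤3^K : a ≤ 3 ^ K
    a≤3^K = ≤-trans (m≤m+n a b) (<⇒≤ (n<3^n K))
    b≤3^K : b ≤ 3 ^ K
    b≤3^K = ≤-trans (m≤n+m b a) (<⇒≤ (n<3^n K))

-- Windows of μ(x) that determine x

-- Rows i-1, …, i+M-2 of μ(x), for x with a rows, leave out at most two of its a*3 rows at either end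
-- (used for columns alike). For a = 3 + s and M = m + 3s this is the theorem's hypothesis on (i, m).
record Margins (a i M : ℕ) : Set where
  field
    lead≤2  : i ∸ 1 ≤ 2
    trail   : ℕ
    trail≤2 : trail ≤ 2
    fills   : i ∸ 1 + M + trail ≡ a * 3

  fits : i ∸ 1 + M ≤ a * 3
  fits = subst (i ∸ 1 + M ≤_) fills (m≤m+n (i ∸ 1 + M) trail)

  M≤a*3 : M ≤ a * 3
  M≤a*3 = ≤-trans (m≤n+m M (i ∸ 1)) fits

  a≤M : 2 ≤ a → a ≤ M
  a≤M 2≤a = +-cancelʳ-≤ 4 a M (begin
    a + 4              ≤⟨ +-monoʳ-≤ a (*-monoˡ-≤ 2 2≤a) ⟩
    a + a * 2          ≡⟨ *-suc a 2 ⟨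
    a * 3              ≡⟨ fills ⟨
    i ∸ 1 + M + trail  ≤⟨ +-mono-≤ (+-monoˡ-≤ M lead≤2) trail≤2 ⟩
    2 + M + 2          ≡⟨ cong (_+ 2) (+-comm 2 M) ⟩
    M + 2 + 2          ≡⟨ +-assoc M 2 2 ⟩
    M + 4              ∎)
    where open ≤-Reasoning

  fits-own : 2 ≤ a → i ∸ 1 + M ≤ M * 3
  fits-own 2≤a = ≤-trans fits (*-monoˡ-≤ 3 (a≤M 2≤a))

  covers : ∀ {x} → x + 3 ≤ a * 3 → i ∸ 1 ≤ x → x ∸ (i ∸ 1) < M
  covers {x} x+3≤ o≤x = subst (x ∸ (i ∸ 1) <_) (m+n∸m≡n (i ∸ 1) M) (∸-monoˡ-< x<o+M o≤x)
    where
    open ≤-Reasoning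
    x<o+M : x < i ∸ 1 + M
    x<o+M = +-cancelʳ-≤ 2 (suc x) (i ∸ 1 + M) (begin
      suc x + 2          ≡⟨ +-suc x 2 ⟨
      x + 3              ≤⟨ x+3≤ ⟩
      a * 3              ≡⟨ fills ⟨
      i ∸ 1 + M + trail  ≤⟨ +-monoʳ-≤ (i ∸ 1 + M) trail≤2 ⟩
      i ∸ 1 + M + 2      ∎)

Margins-widen : ∀ {a i M} s → Margins a i M → Margins (a + s) i (M + 3 * s)
Margins-widen {a} {i} {M} s margins = record
  { lead≤2 = lead≤2 ; trail = trail ; trail≤2 = trail≤2 ; fills = begin
    i ∸ 1 + (M + 3 * s) + trail  ≡⟨ regroup (i ∸ 1) M trail s ⟩
    i ∸ 1 + M + trail + 3 * s    ≡⟨ cong (_+ 3 * s) fills ⟩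
    a * 3 + 3 * s                ≡⟨ factor a s ⟩
    (a + s) * 3                  ∎ }
  where
  open Margins margins
  open ≡-Reasoning
  regroup : ∀ o M e s → o + (M + 3 * s) + e ≡ o + M + e + 3 * s
  regroup = solve-∀
  factor : ∀ a s → a * 3 + 3 * s ≡ (a + s) * 3
  factor = solve-∀

margins₃ : ∀ {o} c e → o ≤ 2 → 2 ≤ c → e ≤ 2 → c + e ≡ 9 → Margins 3 (suc o) (c ∸ o)
margins₃ c e o≤2 2≤c e≤2 c+e≡9 = record
  { lead≤2 = o≤2 ; trail = e ; trail≤2 = e≤2
  ; fills = trans (cong (_+ e) (m+[n∸m]≡n (≤-trans o≤2 2≤c))) c+e≡9 }

baseMargins : ∀ {i m} → 1 ≤ i → i ≤ 3 → m ≡ 8 ∸ i ⊎ m ≡ 9 ∸ i ⊎ m ≡ 10 ∸ i → Margins 3 i m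
baseMargins (s≤s z≤n) (s≤s o≤2) (inj₁ refl)        = margins₃ 7 2 o≤2 (s≤s (s≤s z≤n)) ≤-refl refl
baseMargins (s≤s z≤n) (s≤s o≤2) (inj₂ (inj₁ refl)) = margins₃ 8 1 o≤2 (s≤s (s≤s z≤n)) (s≤s z≤n) refl
baseMargins (s≤s z≤n) (s≤s o≤2) (inj₂ (inj₂ refl)) = margins₃ 9 0 o≤2 (s≤s (s≤s z≤n)) z≤n refl

-- A row of μ(x) through corners of the blocks of x's row α that every window with Margins contains:
-- row 2 for α = 0 since a window may start at row 2, row 3α otherwise since it may end at row 3a-3.
cornerRow : ℕ → ℕ
cornerRow zero    = 2
cornerRow (suc α) = suc α * 3

2≤cornerRow : ∀ α → 2 ≤ cornerRow α
2≤cornerRow zero    = ≤-refl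
2≤cornerRow (suc α) = s≤s (s≤s z≤n)

cornerRow+3≤ : ∀ {a α} → 2 ≤ a → α < a → cornerRow α + 3 ≤ a * 3
cornerRow+3≤ {α = zero}  2≤a _   = ≤-trans (n≤1+n 5) (*-monoˡ-≤ 3 2≤a)
cornerRow+3≤ {α = suc α} _   α<a = ≤-trans (≤-reflexive (+-comm (suc α * 3) 3)) (*-monoˡ-≤ 3 α<a)

block-offMid : ∀ b {x y} → isMid x ≡ false → isMid y ≡ false → block b x y ≡ not b
block-offMid false x≢1 y≢1 rewrite x≢1 | y≢1 = refl
block-offMid true  x≢1 y≢1 rewrite x≢1 | y≢1 = refl

μP-corner : ∀ f α β → μP f (cornerRow α) (cornerRow β) ≡ not (f α β)
μP-corner f α β =
  trans (cong₂ (λ u v → block (f u v) (cornerRow α % 3) (cornerRow β % 3)) (cornerRow/3 α) (cornerRow/3 β))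
        (block-offMid (f α β) (offMid α) (offMid β))
  where
  cornerRow/3 : ∀ α → cornerRow α / 3 ≡ α
  cornerRow/3 zero    = refl
  cornerRow/3 (suc α) = m*n/n≡m (suc α) 3
  offMid : ∀ α → isMid (cornerRow α % 3) ≡ false
  offMid zero    = refl
  offMid (suc α) = cong isMid (m*n%n≡0 (suc α) 3)

entry-corner : ∀ {a b i j M N α β} f → 2 ≤ a → 2 ≤ b → Margins a i M → Margins b j N → α < a → β < b →
               entry (window (μP f) (i ∸ 1) (j ∸ 1) M N) (cornerRow α ∸ (i ∸ 1)) (cornerRow β ∸ (j ∸ 1))
                 ≡ not (f α β)
entry-corner {i = i} {j} {M} {N} {α} {β} f 2≤a 2≤b rows cols α<a β<b = begin
  entry (window (μP f) o o′ M N) (cornerRow α ∸ o) (cornerRow β ∸ o′)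
    ≡⟨ entry-window (μP f) o o′ (Margins.covers rows (cornerRow+3≤ 2≤a α<a) o≤α)
                                (Margins.covers cols (cornerRow+3≤ 2≤b β<b) o′≤β) ⟩
  μP f (o + (cornerRow α ∸ o)) (o′ + (cornerRow β ∸ o′))
    ≡⟨ cong₂ (μP f) (m+[n∸m]≡n o≤α) (m+[n∸m]≡n o′≤β) ⟩
  μP f (cornerRow α) (cornerRow β)
    ≡⟨ μP-corner f α β ⟩
  not (f α β)
    ∎
  where
  open ≡-Reasoning
  o o′ : ℕ
  o = i ∸ 1
  o′ = j ∸ 1
  o≤α : o ≤ cornerRow α
  o≤α = ≤-trans (Margins.lead≤2 rows) (2≤cornerRow α)
  o′≤β : o′ ≤ cornerRow β
  o′≤β = ≤-trans (Margins.lead≤2 cols) (2≤cornerRow β)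

μM-window-injective : ∀ {a b i j M N} → 2 ≤ a → 2 ≤ b → Margins a i M → Margins b j N →
                      Injective _≡_ _≡_ (λ (z : Matrix a b) → sub (μM z) i j M N)
μM-window-injective {a} {b} {i} {j} {M} {N} 2≤a 2≤b rows cols {z} {z′} μz≡μz′ =
  entry-ext λ {α} {β} α<a β<b → Bool.not-injective (begin
    not (entry z α β)
      ≡⟨ entry-corner (entry z) 2≤a 2≤b rows cols α<a β<b ⟨
    entry (window (μP (entry z)) (i ∸ 1) (j ∸ 1) M N) (cornerRow α ∸ (i ∸ 1)) (cornerRow β ∸ (j ∸ 1))
      ≡⟨ cong (λ y → entry y (cornerRow α ∸ (i ∸ 1)) (cornerRow β ∸ (j ∸ 1))) windows≡ ⟩
    entry (window (μP (entry z′)) (i ∸ 1) (j ∸ 1) M N) (cornerRow α ∸ (i ∸ 1)) (cornerRow β ∸ (j ∸ 1))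
      ≡⟨ entry-corner (entry z′) 2≤a 2≤b rows cols α<a β<b ⟩
    not (entry z′ α β)
      ∎)
  where
  open ≡-Reasoning
  windows≡ : window (μP (entry z)) (i ∸ 1) (j ∸ 1) M N ≡ window (μP (entry z′)) (i ∸ 1) (j ∸ 1) M N
  windows≡ = begin
    window (μP (entry z)) (i ∸ 1) (j ∸ 1) M N   ≡⟨ sub-μM z i j (Margins.fits rows) (Margins.fits cols) ⟨
    sub (μM z) i j M N                          ≡⟨ μz≡μz′ ⟩
    sub (μM z′) i j M N                         ≡⟨ sub-μM z′ i j (Margins.fits rows) (Margins.fits cols) ⟩
    window (μP (entry z′)) (i ∸ 1) (j ∸ 1) M N  ∎

InPij⇔image : ∀ {a b i j M N} → 2 ≤ a → 2 ≤ b → Margins a i M → Margins b j N →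
              ∀ y → InPij i j M N y ⇔ ∃ λ z → InP a b z × y ≡ sub (μM z) i j M N
InPij⇔image {a} {b} {i} {j} {M} {N} 2≤a 2≤b rows cols y = mk⇔ restrict extend
  where
  open Margins
  restrict : InPij i j M N y → ∃ λ z → InP a b z × y ≡ sub (μM z) i j M N
  restrict (_ , (k , r , c , r+M≤ , c+N≤ , refl) , refl) =
    window (T k) r c a b ,
    (k , r , c , ≤-trans (+-monoʳ-≤ r (a≤M rows 2≤a)) r+M≤ ,
                 ≤-trans (+-monoʳ-≤ c (a≤M cols 2≤b)) c+N≤ , refl) ,
    trans (sub-μM-window (T k) r c M N i j (fits-own rows 2≤a) (fits-own cols 2≤b))
          (sym (sub-μM-window (T k) r c a b i j (fits rows) (fits cols)))

  grow : ∀ k {r a M} → r + a ≤ 3 ^ k → M ≤ a * 3 → r + M ≤ 3 ^ (k + 2)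
  grow k {r} {a} {M} r+a≤ M≤ = begin
    r + M          ≤⟨ +-mono-≤ (m≤m*n r 9) (≤-trans M≤ (*-monoʳ-≤ a (s≤s (s≤s (s≤s z≤n))))) ⟩
    r * 9 + a * 9  ≡⟨ *-distribʳ-+ 9 r a ⟨
    (r + a) * 9    ≤⟨ *-monoˡ-≤ 9 r+a≤ ⟩
    3 ^ k * 9      ≡⟨ ^-distribˡ-+-* 3 k 2 ⟨
    3 ^ (k + 2)    ∎
    where open ≤-Reasoning

  extend : (∃ λ z → InP a b z × y ≡ sub (μM z) i j M N) → InPij i j M N y
  extend (_ , (k , r , c , r+a≤ , c+b≤ , refl) , refl) =
    window (T (k + 2)) r c M N ,
    (k + 2 , r , c , grow k r+a≤ (M≤a*3 rows) , grow k c+b≤ (M≤a*3 cols) , refl) ,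
    (begin
      sub (μM (window (T k) r c a b)) i j M N
        ≡⟨ sub-μM-window (T k) r c a b i j (fits rows) (fits cols) ⟩
      window (μP (shift (T k) r c)) (i ∸ 1) (j ∸ 1) M N
        ≡⟨ window-cong-within (μP (shift (T k) r c)) (μP (shift (T (k + 2)) r c)) (i ∸ 1) (j ∸ 1)
             (fits rows) (fits cols) (μP-local {a} {b} (AgreeOn-shift r c r+a≤ c+b≤ (T-topLeft k 1))) ⟩
      window (μP (shift (T (k + 2)) r c)) (i ∸ 1) (j ∸ 1) M N
        ≡⟨ sub-μM-window (T (k + 2)) r c M N i j (fits-own rows 2≤a) (fits-own cols 2≤b) ⟨
      sub (μM (window (T (k + 2)) r c M N)) i j M N
        ∎)
    where open ≡-Reasoning

InPij-card : ∀ {a b i j M N size} → 2 ≤ a → 2 ≤ b → Margins a i M → Margins b j N →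
             HasCard (InP a b) size → HasCard (InPij i j M N) size
InPij-card {i = i} {j} {M} {N} 2≤a 2≤b rows cols =
  HasCard-image (λ z → sub (μM z) i j M N) (μM-window-injective 2≤a 2≤b rows cols)
                (InPij⇔image 2≤a 2≤b rows cols)

lemma4 : (i j m n s t : ℕ) →
    1 ≤ i → i ≤ 3 → 1 ≤ j → j ≤ 3 →
    (m ≡ 8 ∸ i ⊎ m ≡ 9 ∸ i ⊎ m ≡ 10 ∸ i) →
    (n ≡ 8 ∸ j ⊎ n ≡ 9 ∸ j ⊎ n ≡ 10 ∸ j) →
    ∃ λ N →
      HasCard (InPij 3 3 (5 + 3 * s) (5 + 3 * t)) N ×
      HasCard (InPij i j (m + 3 * s) (n + 3 * t)) N
lemma4 i j m n s t 1≤i i≤3 1≤j j≤3 m∈ n∈ =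
  size ,
  card (Margins-widen s centre) (Margins-widen t centre) ,
  card (Margins-widen s (baseMargins 1≤i i≤3 m∈)) (Margins-widen t (baseMargins 1≤j j≤3 n∈))
  where
  size : ℕ
  size = proj₁ (InP-finite (3 + s) (3 + t))
  card : ∀ {i j M N} → Margins (3 + s) i M → Margins (3 + t) j N → HasCard (InPij i j M N) size
  card rows cols = InPij-card (s≤s (s≤s z≤n)) (s≤s (s≤s z≤n)) rows cols (proj₂ (InP-finite (3 + s) (3 + t)))
  centre : Margins 3 3 5
  centre = baseMargins {3} (s≤s z≤n) ≤-refl (inj₁ refl)
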